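{- Let $T$ be a linear ranking function template in conjunctive normal form, let $G_T$ be its dependency graph, and let $\eta$ be a suitable coloring for $T$. If $G_T$ has $c$ connected components, then the number of occurrences of atoms colored blue by $\eta$ is at most $c-1$.
   Context: A linear ranking function template over a finite set $F$ of affine-linear function symbols and a finite set $D$ of scalar variables is (in particular) a formula built from atoms of the form $\sum_{f\in F}(\alpha_f f(x)+\beta_f f(x'))+\sum_{d\in D}\gamma_d d\rhd0$, with constants $\alpha_f,\beta_f,\gamma_d$ not all zero and $\rhd\in\{\ge,>\}$; a symbol $f$ (variable $d$) occurs in an atom iff $\alpha_f$ or $\beta_f$ ($\gamma_d$) is nonzero. It is written in CNF $T\equiv\bigwedge_{i\in I}\bigvee_{j\in J_i}T_{i,j}$, where the $T_{i,j}$ are atom occurrences (the same atom may occur several times, and the occurrences are distinguished). The dependency graph $G_T$ has node set $D\cup F$ and an undirected edge between $u$ and $v$ (including $u=v$) iff some atom of $T$ contains both $u$ and $v$; $[u]$ denotes the connected component of $u$. A coloring $\eta$ maps each atom occurrence to one of white (uncolored), red, blue. The coloring graph $G_\eta$ is the directed graph whose nodes are the connected components of $G_T$, with an edge $([u],[v])$ iff there is $i\in I$ such that $u$ occurs in a red occurrence $T_{i,j_1}$ and $v$ occurs in a blue occurrence $T_{i,j_2}$ of the same conjunct $i$. $\eta$ is suitable iff (a) every conjunct contains exactly one red occurrence; (b) for all $u,v\in D\cup F$ occurring in two different blue occurrences, there is no path between $u$ and $v$ in $G_T$; (c) $G_\eta$ is acyclic. -}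

module Defs where

open import Data.Nat using (ℕ; _∸_; _≤_)
open import Data.Fin using (Fin)
open import Data.Sum using (_⊎_; inj₁; inj₂)
open import Data.Product using (Σ; ∃; _×_; _,_)
open import Data.Bool using (Bool; true; false; if_then_else_)
open import Data.List using (List; map; allFin)
open import Data.Nat.ListAction using (sum)
open import Data.Rational using (ℚ; 0ℚ)
open import Relation.Nullary using (¬_)
open import Relation.Binary.PropositionalEquality using (_≡_; _≢_)
open import Relation.Binary.Construct.Closure.ReflexiveTransitive using (Star)
open import Relation.Binary.Construct.Closure.Transitive using (TransClosure)
open import Function.Definitions using (Surjective)

data Cmp : Set where
  ge gt : Cmp

-- An atom  Σ_f (α_f f(x) + β_f f(x')) + Σ_d γ_d d ▷ 0
-- over F = Fin nF (affine-linear function symbols) and D = Fin nD (scalar variables),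
-- with constants not all zero.
record Atom (nF nD : ℕ) : Set where
  field
    α β : Fin nF → ℚ
    γ   : Fin nD → ℚ
    cmp : Cmp
    notAllZero : ¬ ((∀ f → α f ≡ 0ℚ) × (∀ f → β f ≡ 0ℚ) × (∀ d → γ d ≡ 0ℚ))

Node : ℕ → ℕ → Set
Node nF nD = Fin nD ⊎ Fin nF

OccursIn : ∀ {nF nD} → Node nF nD → Atom nF nD → Set
OccursIn (inj₁ d) a = Atom.γ a d ≢ 0ℚ
OccursIn (inj₂ f) a = Atom.α a f ≢ 0ℚ ⊎ Atom.β a f ≢ 0ℚ

-- A template in CNF: conjuncts indexed by I = Fin m, the i-th conjunct has
-- atom occurrences indexed by J_i = Fin (k i).
record CNFTemplate (nF nD : ℕ) : Set where
  field
    m   : ℕ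
    k   : Fin m → ℕ
    occ : (i : Fin m) → Fin (k i) → Atom nF nD

module _ {nF nD : ℕ} (T : CNFTemplate nF nD) where
  open CNFTemplate T

  Occurrence : Set
  Occurrence = Σ (Fin m) (λ i → Fin (k i))

  atomOf : Occurrence → Atom nF nD
  atomOf (i , j) = occ i j

  DepEdge : Node nF nD → Node nF nD → Set
  DepEdge u v = ∃ λ (o : Occurrence) → OccursIn u (atomOf o) × OccursIn v (atomOf o)

  Path : Node nF nD → Node nF nD → Set
  Path = Star DepEdge

  -- G_T has exactly c connected components: comp identifies the set of
  -- connected components with Fin c (surjective, and comp u ≡ comp v iff u, v connected)
  record ComponentLabeling (c : ℕ) : Set where
    field
      comp       : Node nF nD → Fin c
      surjective : Surjective _≡_ _≡_ comp
      sound      : ∀ u v → comp u ≡ comp v → Path u v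
      complete   : ∀ u v → Path u v → comp u ≡ comp v

data Color : Set where
  white red blue : Color

isBlue : Color → Bool
isBlue blue = true
isBlue _    = false

module _ {nF nD : ℕ} (T : CNFTemplate nF nD) where
  open CNFTemplate T

  Coloring : Set
  Coloring = (i : Fin m) → Fin (k i) → Color

  colorOf : Coloring → Occurrence T → Color
  colorOf η (i , j) = η i j

  ColEdge : ∀ {c} → ComponentLabeling T c → Coloring → Fin c → Fin c → Set
  ColEdge L η a b = ∃ λ (u : Node nF nD) → ∃ λ (v : Node nF nD) →
    ComponentLabeling.comp L u ≡ a × ComponentLabeling.comp L v ≡ b ×
    ∃ λ (i : Fin m) → ∃ λ (j₁ : Fin (k i)) → ∃ λ (j₂ : Fin (k i)) →
      η i j₁ ≡ red × η i j₂ ≡ blue × OccursIn u (occ i j₁) × OccursIn v (occ i j₂)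

  Acyclic : ∀ {c} → (Fin c → Fin c → Set) → Set
  Acyclic E = ∀ a → ¬ TransClosure E a a

  record Suitable {c} (L : ComponentLabeling T c) (η : Coloring) : Set where
    field
      oneRed : ∀ i → ∃ λ j → η i j ≡ red × (∀ j' → η i j' ≡ red → j' ≡ j)
      blueSep : ∀ (o₁ o₂ : Occurrence T) → o₁ ≢ o₂ →
                colorOf η o₁ ≡ blue → colorOf η o₂ ≡ blue →
                ∀ u v → OccursIn u (atomOf T o₁) → OccursIn v (atomOf T o₂) →
                ¬ Path T u v
      acyclic : Acyclic (ColEdge L η)

  blueCount : Coloring → ℕ
  blueCount η = sum (map (λ i → sum (map (λ j → if isBlue (η i j) then 1 else 0)
                                         (allFin (k i))))
                         (allFin m))

module Submission where

-- Let b be the number of blue occurrences and pick, for each blue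
-- occurrence, a symbol occurring in it; send the occurrence to the connected
-- component of that symbol.  By suitability (b) this map from blue occurrences
-- to the c components is injective.  By suitability (a) the conjunct of a blue
-- occurrence has a red occurrence, which yields an edge of the coloring graph
-- G_η into the component of the blue occurrence.  If b ≥ c, the injection is
-- onto, so every node of G_η has an incoming edge; walking backwards along
-- such edges must revisit a node (pigeonhole), producing a cycle that
-- contradicts suitability (c).

open import Defs
open import Data.Nat using (ℕ; zero; suc; _+_; _≤_; _∸_; _<?_; z≤n)
open import Data.Nat.Properties using (+-comm; n<1+n; ∸-monoˡ-≤; ≤⇒≯; ≮⇒≥; m≤n⇒∃[o]m+o≡n)
open import Data.Nat.ListAction using (sum)
open import Data.Fin using (Fin; toℕ; _≟_)
open import Data.Fin.Properties using (pigeonhole; injective⇒≤; any?; all?; ¬∀⟶∃¬)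
open import Data.Rational using (ℚ; 0ℚ)
import Data.Rational.Properties as ℚ
open import Data.Sum using (inj₁; inj₂)
open import Data.Product using (∃; _,_; proj₁; proj₂)
open import Data.Bool as Bool using (true; false; if_then_else_)
open import Data.Empty using (⊥-elim)
open import Data.List using (List; []; _∷_; map; allFin; filter; concat; length; lookup)
open import Data.List.Properties using (length-++; length-map; map-cong)
open import Data.List.Membership.Propositional using (_∈_)
open import Data.List.Membership.Propositional.Properties using (∈-lookup; ∈-map⁻)
open import Data.List.Relation.Unary.All as All using (All)
import Data.List.Relation.Unary.All.Properties as All
import Data.List.Relation.Unary.AllPairs as AllPairs
import Data.List.Relation.Unary.AllPairs.Properties as AllPairs
open import Data.List.Relation.Unary.Unique.Propositional using (Unique)
import Data.List.Relation.Unary.Unique.Propositional.Properties as Unique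
open import Function.Base using (_∘′_)
open import Function.Definitions using (Injective)
open import Relation.Nullary using (¬_; yes; no; contradiction)
open import Relation.Nullary.Decidable using (T?)
open import Relation.Binary.PropositionalEquality
open import Relation.Binary.Construct.Closure.Transitive using (TransClosure; [_]; _∷_)

-- An injection Fin n → Fin c with c ≤ n is onto: a missed value a could be
-- prepended to it, giving an injection Fin (suc n) → Fin c.
injective⇒surjective : ∀ {n c} {g : Fin n → Fin c} → Injective _≡_ _≡_ g →
                       c ≤ n → ∀ a → ∃ λ i → g i ≡ a
injective⇒surjective {n} {c} {g} g-inj c≤n a with any? (λ i → g i ≟ a)
... | yes hit  = hit
... | no  miss = contradiction (injective⇒≤ extended-injective) (≤⇒≯ c≤n)
  where
  extended : Fin (suc n) → Fin c
  extended Fin.zero    = a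
  extended (Fin.suc i) = g i

  extended-injective : Injective _≡_ _≡_ extended
  extended-injective {Fin.zero}  {Fin.zero}  _  = refl
  extended-injective {Fin.zero}  {Fin.suc j} eq = contradiction (j , sym eq) miss
  extended-injective {Fin.suc i} {Fin.zero}  eq = contradiction (i , eq) miss
  extended-injective {Fin.suc i} {Fin.suc j} eq = cong Fin.suc (g-inj eq)

-- A finite graph in which every node has a predecessor contains a cycle,
-- provided it has a node at all: walking backwards must revisit a node.
module Backwards {c : ℕ} (E : Fin c → Fin c → Set)
                 (predecessor : ∀ a → ∃ λ b → E b a) where

  back : ℕ → Fin c → Fin c
  back zero    a = a
  back (suc k) a = proj₁ (predecessor (back k a))

  back-+ : ∀ d i a → back (d + i) a ≡ back d (back i a)
  back-+ zero    i a = refl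
  back-+ (suc d) i a = cong (λ x → proj₁ (predecessor x)) (back-+ d i a)

  walk : ∀ d a → TransClosure E (back (suc d) a) a
  walk zero    a = [ proj₂ (predecessor a) ]
  walk (suc d) a = proj₂ (predecessor (back (suc d) a)) ∷ walk d a

  revisit⇒cycle : ∀ a i d → back (suc d + i) a ≡ back i a →
                  ∃ λ x → TransClosure E x x
  revisit⇒cycle a i d returns =
    back i a ,
    subst (λ x → TransClosure E x (back i a))
          (trans (sym (back-+ (suc d) i a)) returns) (walk d (back i a))

  -- among the c + 1 nodes back 0 a, …, back c a two coincide (pigeonhole)
  predecessors⇒cycle : Fin c → ∃ λ x → TransClosure E x x
  predecessors⇒cycle a =
    let (i , j , i<j , same) = pigeonhole (n<1+n c) (λ (x : Fin (suc c)) → back (toℕ x) a)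
        (d , i+d≡j)          = m≤n⇒∃[o]m+o≡n i<j
        steps : suc d + toℕ i ≡ toℕ j
        steps = trans (cong suc (+-comm d (toℕ i))) i+d≡j
    in revisit⇒cycle a (toℕ i) d (trans (cong (λ t → back t a) steps) (sym same))

open Backwards using (predecessors⇒cycle)

injection-into-acyclic : ∀ {n c} (E : Fin c → Fin c → Set) →
                         (∀ a → ¬ TransClosure E a a) →
                         (g : Fin n → Fin c) → Injective _≡_ _≡_ g →
                         (∀ i → ∃ λ b → E b (g i)) → n ≤ c ∸ 1
injection-into-acyclic {zero}      E acyclic g g-inj hasPredecessor = z≤n
injection-into-acyclic {suc n} {c} E acyclic g g-inj hasPredecessor with suc n <? c
... | yes 1+n<c = ∸-monoˡ-≤ 1 1+n<c
... | no  1+n≮c =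
  let (x , cycle) = predecessors⇒cycle E everyPredecessor (g Fin.zero) in
  contradiction cycle (acyclic x)
  where
  everyPredecessor : ∀ a → ∃ λ b → E b a
  everyPredecessor a with i , refl ← injective⇒surjective g-inj (≮⇒≥ 1+n≮c) a =
    hasPredecessor i

lookup-injective : ∀ {A : Set} {xs : List A} → Unique xs → Injective _≡_ _≡_ (lookup xs)
lookup-injective {xs = x ∷ xs} (x∉ AllPairs.∷ u) {Fin.zero}  {Fin.zero}  _  = refl
lookup-injective {xs = x ∷ xs} (x∉ AllPairs.∷ u) {Fin.zero}  {Fin.suc j} eq =
  contradiction eq (All.lookup x∉ (∈-lookup j))
lookup-injective {xs = x ∷ xs} (x∉ AllPairs.∷ u) {Fin.suc i} {Fin.zero}  eq =
  contradiction (sym eq) (All.lookup x∉ (∈-lookup i))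
lookup-injective {xs = x ∷ xs} (x∉ AllPairs.∷ u) {Fin.suc i} {Fin.suc j} eq =
  cong Fin.suc (lookup-injective u eq)

length-concat-map : ∀ {A B : Set} (f : A → List B) (xs : List A) →
                    length (concat (map f xs)) ≡ sum (map (λ x → length (f x)) xs)
length-concat-map f []       = refl
length-concat-map f (x ∷ xs) =
  trans (length-++ (f x)) (cong (length (f x) +_) (length-concat-map f xs))

length-filter-count : ∀ {A : Set} (b : A → Bool.Bool) (xs : List A) →
                      length (filter (λ x → T? (b x)) xs) ≡
                      sum (map (λ x → if b x then 1 else 0) xs)
length-filter-count b []       = refl
length-filter-count b (x ∷ xs) with b x
... | true  = cong suc (length-filter-count b xs)
... | false = length-filter-count b xs

nonzeroEntry : ∀ {n} (v : Fin n → ℚ) → ¬ (∀ i → v i ≡ 0ℚ) → ∃ λ i → v i ≢ 0ℚ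
nonzeroEntry {n} v = ¬∀⟶∃¬ n _ (λ i → v i ℚ.≟ 0ℚ)

occurringNode : ∀ {nF nD} (a : Atom nF nD) → ∃ λ u → OccursIn u a
occurringNode a
  with all? (λ d → Atom.γ a d ℚ.≟ 0ℚ) | all? (λ f → Atom.α a f ℚ.≟ 0ℚ)
     | all? (λ f → Atom.β a f ℚ.≟ 0ℚ)
... | no γ≢0 | _      | _      = let (d , nz) = nonzeroEntry (Atom.γ a) γ≢0 in inj₁ d , nz
... | yes _  | no α≢0 | _      = let (f , nz) = nonzeroEntry (Atom.α a) α≢0 in inj₂ f , inj₁ nz
... | yes _  | yes _  | no β≢0 = let (f , nz) = nonzeroEntry (Atom.β a) β≢0 in inj₂ f , inj₂ nz
... | yes γ0 | yes α0 | yes β0 = ⊥-elim (Atom.notAllZero a (α0 , β0 , γ0))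

isBlue⇒blue : ∀ col → Bool.T (isBlue col) → col ≡ blue
isBlue⇒blue blue _ = refl

module BlueOccurrences {nF nD : ℕ} (T : CNFTemplate nF nD) (η : Coloring T) where
  open CNFTemplate T

  isBlueAt : (i : Fin m) → Fin (k i) → Bool.Bool
  isBlueAt i j = isBlue (η i j)

  occurrenceAt : (i : Fin m) → Fin (k i) → Occurrence T
  occurrenceAt i j = i , j

  blueIn : (i : Fin m) → List (Occurrence T)
  blueIn i = map (occurrenceAt i) (filter (λ j → T? (isBlueAt i j)) (allFin (k i)))

  blueOccurrences : List (Occurrence T)
  blueOccurrences = concat (map blueIn (allFin m))

  length-blueOccurrences : length blueOccurrences ≡ blueCount T η
  length-blueOccurrences =
    trans (length-concat-map blueIn (allFin m)) (cong sum (map-cong length-blueIn (allFin m)))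
    where
    length-blueIn : ∀ i → length (blueIn i) ≡
                          sum (map (λ j → if isBlueAt i j then 1 else 0) (allFin (k i)))
    length-blueIn i = trans (length-map (occurrenceAt i) (filter (λ j → T? (isBlueAt i j)) (allFin (k i))))
                            (length-filter-count (isBlueAt i) (allFin (k i)))

  blueIn-conjunct : ∀ i {o} → o ∈ blueIn i → proj₁ o ≡ i
  blueIn-conjunct i o∈ with _ , _ , refl ← ∈-map⁻ (occurrenceAt i) o∈ = refl

  blueOccurrences-unique : Unique blueOccurrences
  blueOccurrences-unique = Unique.concat⁺
    (All.map⁺ (All.tabulate λ {i} _ →
      Unique.map⁺ (λ { refl → refl })
        (Unique.filter⁺ (λ j → T? (isBlueAt i j)) (Unique.allFin⁺ (k i)))))
    (AllPairs.map⁺ (AllPairs.map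
      (λ {i} {i′} i≢i′ {_} (o∈ , o∈′) → i≢i′ (trans (sym (blueIn-conjunct i o∈)) (blueIn-conjunct i′ o∈′)))
      (Unique.allFin⁺ m)))

  blueOccurrences-blue : All (λ o → colorOf T η o ≡ blue) blueOccurrences
  blueOccurrences-blue = All.concat⁺ (All.map⁺ {f = blueIn} (All.tabulate {xs = allFin m} λ {i} _ →
    All.map⁺ (All.map (λ {j} → isBlue⇒blue (η i j))
                      (All.all-filter (λ j → T? (isBlueAt i j)) (allFin (k i))))))

module SuitableColoring {nF nD : ℕ} {T : CNFTemplate nF nD} {c : ℕ}
                        {L : ComponentLabeling T c} {η : Coloring T}
                        (suitable : Suitable T L η) where
  open CNFTemplate T
  open ComponentLabeling L
  open Suitable suitable
  open BlueOccurrences T η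

  symbolOf : Occurrence T → Node nF nD
  symbolOf o = proj₁ (occurringNode (atomOf T o))

  blue-components-differ : ∀ o₁ o₂ → o₁ ≢ o₂ →
                           colorOf T η o₁ ≡ blue → colorOf T η o₂ ≡ blue →
                           comp (symbolOf o₁) ≢ comp (symbolOf o₂)
  blue-components-differ o₁ o₂ o₁≢o₂ blue₁ blue₂ same =
    blueSep o₁ o₂ o₁≢o₂ blue₁ blue₂ (symbolOf o₁) (symbolOf o₂)
            (proj₂ (occurringNode (atomOf T o₁))) (proj₂ (occurringNode (atomOf T o₂)))
            (sound _ _ same)

  blue-component-has-predecessor : ∀ o → colorOf T η o ≡ blue →
                                   ∃ λ a → ColEdge T L η a (comp (symbolOf o))
  blue-component-has-predecessor (i , j) isBlueⱼ with r , isRed , _ ← oneRed i =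
    comp (symbolOf (i , r)) , symbolOf (i , r) , symbolOf (i , j) , refl , refl ,
    i , r , j , isRed , isBlueⱼ ,
    proj₂ (occurringNode (occ i r)) , proj₂ (occurringNode (occ i j))

  blueComponent : Fin (length blueOccurrences) → Fin c
  blueComponent p = comp (symbolOf (lookup blueOccurrences p))

  blue-at-position : ∀ p → colorOf T η (lookup blueOccurrences p) ≡ blue
  blue-at-position p = All.lookup blueOccurrences-blue (∈-lookup p)

  blueComponent-injective : Injective _≡_ _≡_ blueComponent
  blueComponent-injective {p} {q} same with p ≟ q
  ... | yes p≡q = p≡q
  ... | no  p≢q = contradiction same
    (blue-components-differ _ _ (p≢q ∘′ lookup-injective blueOccurrences-unique)
                            (blue-at-position p) (blue-at-position q))

lemma6p8 : ∀ {nF nD : ℕ} (T : CNFTemplate nF nD) (c : ℕ)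
           (L : ComponentLabeling T c) (η : Coloring T) →
           Suitable T L η →
           blueCount T η ≤ c ∸ 1
lemma6p8 T c L η suitable =
  subst (_≤ c ∸ 1) length-blueOccurrences
    (injection-into-acyclic (ColEdge T L η) acyclic blueComponent blueComponent-injective
       (λ p → blue-component-has-predecessor _ (blue-at-position p)))
  where
  open BlueOccurrences T η
  open SuitableColoring suitable
  open Suitable suitable using (acyclic)
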